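{- Let $P_n$ be the path on $n\ge 1$ vertices. Then $TTr(P_n)=1$ if $n\in\{1,2\}$, $TTr(P_n)=2$ if $n\in\{3,4\}$, and $TTr(P_n)=3$ if $n\ge 5$.
   Context: All graphs are finite and simple. For disjoint vertex sets $A,B$, $A$ dominates $B$ if every vertex of $B$ has a neighbour in $A$. A tournament transitive partition of order $k$ of $G=(V,E)$ is a partition $\{V_1,\dots,V_k\}$ of $V$ into nonempty sets such that for all $1\le i<j\le k$, $V_i$ dominates $V_j$ and $V_j$ does not dominate $V_i$. The tournament transitivity $TTr(G)$ is the maximum $k$ for which such a partition exists. -}

module Defs where

open import Data.Nat using (ℕ; suc; _≤_)
open import Data.Fin using (Fin; toℕ; _<_)
open import Data.Product using (Σ; ∃; _×_)
open import Data.Sum using (_⊎_)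
open import Relation.Binary.PropositionalEquality using (_≡_)
open import Relation.Nullary using (¬_)
open import Level using (0ℓ)

record Graph (n : ℕ) : Set₁ where
  field
    Adj      : Fin n → Fin n → Set
    adj-sym  : ∀ {u v} → Adj u v → Adj v u
    irrefl   : ∀ {u} → ¬ Adj u u
open Graph public

PathAdj : ∀ {n} → Fin n → Fin n → Set
PathAdj u v = suc (toℕ u) ≡ toℕ v ⊎ suc (toℕ v) ≡ toℕ u

PathGraph : (n : ℕ) → Graph n
PathGraph n = record { Adj = PathAdj ; adj-sym = sy ; irrefl = irr }
  where
  open import Data.Sum using (inj₁; inj₂)
  open import Data.Nat.Properties using (<-irrefl; n<1+n)
  open import Relation.Binary.PropositionalEquality using (sym)
  sy : ∀ {u v} → PathAdj {n} u v → PathAdj v u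
  sy (inj₁ p) = inj₂ p
  sy (inj₂ p) = inj₁ p
  irr : ∀ {u} → ¬ PathAdj {n} u u
  irr (inj₁ p) = <-irrefl (sym p) (n<1+n _)
  irr (inj₂ p) = <-irrefl (sym p) (n<1+n _)

-- A partition {V_1,…,V_k} of V into k classes, encoded by the class-assignment
-- map part : V → Fin k (V_i = part⁻¹(i)); classes are nonempty iff part is surjective.
Dominates : ∀ {n k} → Graph n → (Fin n → Fin k) → Fin k → Fin k → Set
Dominates G part i j = ∀ v → part v ≡ j → ∃ λ u → part u ≡ i × Adj G u v

record TTPartition {n : ℕ} (G : Graph n) (k : ℕ) : Set where
  field
    part      : Fin n → Fin k
    nonempty  : ∀ i → ∃ λ v → part v ≡ i
    dom       : ∀ i j → i < j → Dominates G part i j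
    notDom    : ∀ i j → i < j → ¬ Dominates G part j i

TTrIs : ∀ {n} → Graph n → ℕ → Set
TTrIs G k = TTPartition G k × (∀ m → TTPartition G m → m ≤ k)

{-# OPTIONS --safe #-}
-- A vertex in the last class of a tournament transitive partition has a neighbour in
-- every earlier class, so a graph of maximum degree 2 has TTr ≤ 3. Merging the first
-- two classes of a partition of order k + 1 yields one of order k; hence TTr(G) = k as
-- soon as some partition of order k exists and none of order k + 1 does. For P₅ the
-- classes {1, 4}, {0, 2}, {3} work, and every further vertex appended to the path can
-- join the first class. The remaining cases P₁, …, P₄ are finite checks.
module Submission where

open import Defs
open import Data.Nat using (ℕ; suc; _≤_)
open import Data.Product using (_×_)

open import Data.Nat.Base using (zero; _+_; z<s; s<s; _≤′_; ≤′-refl; ≤′-reflexive; ≤′-step)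
open import Data.Nat.Properties using (≮⇒≥; ≤⇒≤′; m≤n⇒∃[o]m+o≡n; suc-injective)
open import Data.Fin using (#_)
open import Data.Fin.Base using (Fin; zero; suc; toℕ; _<_; pinch; inject₁; lower₁; finToFun; funToFin)
open import Data.Fin.Properties using (all?; any?; _<?_; _≟_; 0≢1+n; toℕ-inject₁; toℕ-lower₁; toℕ-injective; finToFun-funToFin)
open import Data.Product using (∃; Σ-syntax; _,_)
open import Data.Sum using (_⊎_; inj₁; inj₂)
open import Function using (_∘_)
open import Relation.Binary.Definitions using (Decidable)
open import Relation.Binary.PropositionalEquality using (_≡_; refl; sym; trans; cong; subst₂; _≗_)
open import Relation.Nullary using (¬_; Dec; contradiction)
open import Relation.Nullary.Decidable using (True; False; toWitness; toWitnessFalse; from-yes; map′; ¬?; _×-dec_; _⊎-dec_; _→-dec_)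
import Data.Nat.Properties as ℕ

private
  variable
    n k : ℕ

IsTTPartition : Graph n → (Fin n → Fin k) → Set
IsTTPartition G part =
  (∀ i → ∃ λ v → part v ≡ i) ×
  (∀ i j → i < j → Dominates G part i j) ×
  (∀ i j → i < j → ¬ Dominates G part j i)

mkTTPartition : {G : Graph n} {part : Fin n → Fin k} → IsTTPartition G part → TTPartition G k
mkTTPartition (nonempty , dom , notDom) =
  record { part = _ ; nonempty = nonempty ; dom = dom ; notDom = notDom }

isTTPartition : {G : Graph n} (P : TTPartition G k) → IsTTPartition G (TTPartition.part P)
isTTPartition P = nonempty , dom , notDom
  where open TTPartition P

Dominates-resp-≗ : {G : Graph n} {f g : Fin n → Fin k} → f ≗ g →
                   ∀ {i j} → Dominates G f i j → Dominates G g i j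
Dominates-resp-≗ f≗g i▹j v gv≡j =
  let u , fu≡i , u~v = i▹j v (trans (f≗g v) gv≡j)
  in u , trans (sym (f≗g u)) fu≡i , u~v

IsTTPartition-resp-≗ : {G : Graph n} {f g : Fin n → Fin k} → f ≗ g →
                       IsTTPartition G f → IsTTPartition G g
IsTTPartition-resp-≗ {G = G} f≗g (nonempty , dom , notDom) =
  (λ i → let v , fv≡i = nonempty i in v , trans (sym (f≗g v)) fv≡i) ,
  (λ i j i<j → Dominates-resp-≗ {G = G} f≗g (dom i j i<j)) ,
  (λ i j i<j → notDom i j i<j ∘ Dominates-resp-≗ {G = G} (sym ∘ f≗g))

-- pinch zero sends classes 0 and 1 to 0 and shifts the others down, so new class i
-- contains old class suc i, and equals it when i ≠ 0.
mergeFirstClasses : {G : Graph n} → TTPartition G (suc (suc k)) → TTPartition G (suc k)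
mergeFirstClasses P = record
  { part     = pinch zero ∘ part
  ; nonempty = λ i → let v , v∈i = nonempty (suc i) in v , cong (pinch zero) v∈i
  ; dom      = λ where
      i (suc j) i<j v v∈j →
        let u , u∈i , u~v = dom (suc i) (suc (suc j)) (s<s i<j) v (pinch-zero-≡-suc v∈j)
        in u , cong (pinch zero) u∈i , u~v
  ; notDom   = λ where
      i (suc j) i<j j▹i → notDom (suc i) (suc (suc j)) (s<s i<j) λ v v∈i →
        let u , u∈j , u~v = j▹i v (cong (pinch zero) v∈i)
        in u , pinch-zero-≡-suc u∈j , u~v
  }
  where
  open TTPartition P
  pinch-zero-≡-suc : ∀ {x : Fin (suc (suc k))} {j} → pinch zero x ≡ suc j → x ≡ suc (suc j)
  pinch-zero-≡-suc {x = zero}  ()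
  pinch-zero-≡-suc {x = suc x} refl = refl

lowerOrder : ∀ {G : Graph n} {m} → suc m ≤′ k → TTPartition G k → TTPartition G (suc m)
lowerOrder ≤′-refl                 P = P
lowerOrder (≤′-step {suc _} sm≤k) P = lowerOrder sm≤k (mergeFirstClasses P)
lowerOrder (≤′-step {zero} (≤′-reflexive ()))

TTrIs-intro : {G : Graph n} → TTPartition G k → ¬ TTPartition G (suc k) → TTrIs G k
TTrIs-intro P noP = P , λ m Q → ≮⇒≥ λ k<m → noP (lowerOrder (≤⇒≤′ k<m) Q)

module _ {G : Graph n} (adj? : Decidable (Adj G)) where

  dominates? : (part : Fin n → Fin k) → ∀ i j → Dec (Dominates G part i j)
  dominates? part i j = all? λ v → part v ≟ j →-dec any? λ u → part u ≟ i ×-dec adj? u v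

  isTTPartition? : (part : Fin n → Fin k) → Dec (IsTTPartition G part)
  isTTPartition? part =
    all? (λ i → any? λ v → part v ≟ i) ×-dec
    all? (λ i → all? λ j → i <? j →-dec dominates? part i j) ×-dec
    all? (λ i → all? λ j → i <? j →-dec ¬? (dominates? part j i))

  ttPartition? : ∀ k → Dec (TTPartition G k)
  ttPartition? k = map′
    (λ (_ , isTT) → mkTTPartition isTT)
    (λ P → let part = TTPartition.part P in
      funToFin part , IsTTPartition-resp-≗ {G = G} (sym ∘ finToFun-funToFin part) (isTTPartition P))
    (any? λ f → isTTPartition? (finToFun f))

  TTrIs-byDecision : ∀ k → True (ttPartition? k) → False (ttPartition? (suc k)) → TTrIs G k
  TTrIs-byDecision k P noP = TTrIs-intro (toWitness P) (toWitnessFalse noP)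

MaxDegree≤2 : Graph n → Set
MaxDegree≤2 G = ∀ {v a b c} → Adj G a v → Adj G b v → Adj G c v → a ≡ b ⊎ a ≡ c ⊎ b ≡ c

maxDegree≤2⇒¬TTPartition4 : {G : Graph n} → MaxDegree≤2 G → ¬ TTPartition G 4
maxDegree≤2⇒¬TTPartition4 maxDeg P = lastClassEmpty (nonempty (# 3))
  where
  open TTPartition P
  lastClassEmpty : ¬ ∃ λ v → part v ≡ # 3
  lastClassEmpty (v , v∈3)
    with u₀ , u₀∈0 , u₀~v ← dom (# 0) (# 3) z<s v v∈3
       | u₁ , u₁∈1 , u₁~v ← dom (# 1) (# 3) (s<s z<s) v v∈3
       | u₂ , u₂∈2 , u₂~v ← dom (# 2) (# 3) (s<s (s<s z<s)) v v∈3
    with maxDeg u₀~v u₁~v u₂~v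
  ... | inj₁ refl        = contradiction (trans (sym u₀∈0) u₁∈1) λ ()
  ... | inj₂ (inj₁ refl) = contradiction (trans (sym u₀∈0) u₂∈2) λ ()
  ... | inj₂ (inj₂ refl) = contradiction (trans (sym u₁∈1) u₂∈2) λ ()

pathAdj? : Decidable (PathAdj {n})
pathAdj? u v = suc (toℕ u) ℕ.≟ toℕ v ⊎-dec suc (toℕ v) ℕ.≟ toℕ u

PathAdj-cong : ∀ {m} {u v : Fin n} {u′ v′ : Fin m} →
               toℕ u ≡ toℕ u′ → toℕ v ≡ toℕ v′ → PathAdj u v → PathAdj u′ v′
PathAdj-cong = subst₂ λ a b → suc a ≡ b ⊎ suc b ≡ a

leftNeighbour-unique : {a b v : Fin n} → suc (toℕ a) ≡ toℕ v → suc (toℕ b) ≡ toℕ v → a ≡ b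
leftNeighbour-unique a+1≡v b+1≡v = toℕ-injective (suc-injective (trans a+1≡v (sym b+1≡v)))

rightNeighbour-unique : {a b v : Fin n} → suc (toℕ v) ≡ toℕ a → suc (toℕ v) ≡ toℕ b → a ≡ b
rightNeighbour-unique v+1≡a v+1≡b = toℕ-injective (trans (sym v+1≡a) v+1≡b)

pathGraph-maxDegree≤2 : MaxDegree≤2 (PathGraph n)
pathGraph-maxDegree≤2 (inj₁ a+1≡v) (inj₁ b+1≡v) _ = inj₁ (leftNeighbour-unique a+1≡v b+1≡v)
pathGraph-maxDegree≤2 (inj₂ v+1≡a) (inj₂ v+1≡b) _ = inj₁ (rightNeighbour-unique v+1≡a v+1≡b)
pathGraph-maxDegree≤2 (inj₁ a+1≡v) (inj₂ _) (inj₁ c+1≡v) = inj₂ (inj₁ (leftNeighbour-unique a+1≡v c+1≡v))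
pathGraph-maxDegree≤2 (inj₂ v+1≡a) (inj₁ _) (inj₂ v+1≡c) = inj₂ (inj₁ (rightNeighbour-unique v+1≡a v+1≡c))
pathGraph-maxDegree≤2 (inj₁ _) (inj₂ v+1≡b) (inj₂ v+1≡c) = inj₂ (inj₂ (rightNeighbour-unique v+1≡b v+1≡c))
pathGraph-maxDegree≤2 (inj₂ _) (inj₁ b+1≡v) (inj₁ c+1≡v) = inj₂ (inj₂ (leftNeighbour-unique b+1≡v c+1≡v))

-- The appended vertex needs no dominating neighbour, and being in the first class it is
-- never the neighbour that some later class would need.
appendFirstClass : {c : ℕ → Fin (suc k)} → c n ≡ zero →
                   IsTTPartition (PathGraph n) (c ∘ toℕ) → IsTTPartition (PathGraph (suc n)) (c ∘ toℕ)
appendFirstClass {n = n} {c = c} cn≡0 (nonempty , dom , notDom) = nonempty′ , dom′ , notDom′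
  where
  inject₁-class : ∀ {i} (v : Fin n) → c (toℕ v) ≡ i → c (toℕ (inject₁ v)) ≡ i
  inject₁-class v = trans (cong c (toℕ-inject₁ v))

  shrink : ∀ {j} (v : Fin (suc n)) → c (toℕ v) ≡ suc j → Σ[ v′ ∈ Fin n ] toℕ v′ ≡ toℕ v
  shrink v v∈j = lower₁ v n≢v , toℕ-lower₁ v n≢v
    where n≢v = λ n≡v → 0≢1+n (trans (sym cn≡0) (trans (cong c n≡v) v∈j))

  nonempty′ : ∀ i → ∃ λ v → c (toℕ v) ≡ i
  nonempty′ i = let v , v∈i = nonempty i in inject₁ v , inject₁-class v v∈i

  dom′ : ∀ i j → i < j → Dominates (PathGraph (suc n)) (c ∘ toℕ) i j
  dom′ i (suc j) i<j v v∈j =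
    let v′ , v′≡v     = shrink v v∈j
        u , u∈i , u~v′ = dom i (suc j) i<j v′ (trans (cong c v′≡v) v∈j)
    in inject₁ u , inject₁-class u u∈i , PathAdj-cong (sym (toℕ-inject₁ u)) v′≡v u~v′

  notDom′ : ∀ i j → i < j → ¬ Dominates (PathGraph (suc n)) (c ∘ toℕ) j i
  notDom′ i (suc j) i<j j▹i = notDom i (suc j) i<j λ v v∈i →
    let u , u∈j , u~v = j▹i (inject₁ v) (inject₁-class v v∈i)
        u′ , u′≡u     = shrink u u∈j
    in u′ , trans (cong c u′≡u) u∈j , PathAdj-cong (sym u′≡u) (toℕ-inject₁ v) u~v

pathPattern : ℕ → Fin 3
pathPattern 0 = # 1
pathPattern 1 = # 0
pathPattern 2 = # 1
pathPattern 3 = # 2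
pathPattern _ = # 0

pathPattern-isTTPartition : ∀ d → IsTTPartition (PathGraph (5 + d)) (pathPattern ∘ toℕ)
pathPattern-isTTPartition zero    = from-yes (isTTPartition? {G = PathGraph 5} pathAdj? (pathPattern ∘ toℕ))
pathPattern-isTTPartition (suc d) = appendFirstClass {c = pathPattern} refl (pathPattern-isTTPartition d)

pathGraph-TTPartition3 : 5 ≤ n → TTPartition (PathGraph n) 3
pathGraph-TTPartition3 5≤n with d , refl ← m≤n⇒∃[o]m+o≡n 5≤n =
  mkTTPartition (pathPattern-isTTPartition d)

proposition8 : TTrIs (PathGraph 1) 1 × TTrIs (PathGraph 2) 1 × TTrIs (PathGraph 3) 2 × TTrIs (PathGraph 4) 2
    × (∀ n → 5 ≤ n → TTrIs (PathGraph n) 3)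
proposition8 =
  TTrIs-byDecision {G = PathGraph 1} pathAdj? 1 _ _ ,
  TTrIs-byDecision {G = PathGraph 2} pathAdj? 1 _ _ ,
  TTrIs-byDecision {G = PathGraph 3} pathAdj? 2 _ _ ,
  TTrIs-byDecision {G = PathGraph 4} pathAdj? 2 _ _ ,
  λ n 5≤n → TTrIs-intro (pathGraph-TTPartition3 5≤n) (maxDegree≤2⇒¬TTPartition4 pathGraph-maxDegree≤2)
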